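{- The sequent calculus $\mathtt{CHC}$ admits cut elimination: every sequent derivable in $\mathtt{CHC}$ (from no assumptions) has a derivation in $\mathtt{CHC}$ that does not use the rule (cut).
   Context: Formulas are built from variables with binary $\wedge,\vee,\rightarrow$ and constants $0,1$; $\neg\alpha:=\alpha\rightarrow 0$. A sequent $\Gamma\blacktriangleright\Pi$ is a pair of a finite set $\Gamma$ of formulas and a set $\Pi$ (the stoup) that is empty or a singleton; commas denote union. The calculus $\mathtt{CHC}$ has axioms (id) $\alpha\blacktriangleright\alpha$; (0) $0\blacktriangleright$; (1) $\blacktriangleright 1$; structural rules (w-l) from $\Gamma\blacktriangleright\Pi$ infer $\alpha,\Gamma\blacktriangleright\Pi$; (w-r) from $\Gamma\blacktriangleright$ infer $\Gamma\blacktriangleright\alpha$; (cut) from $\Gamma\blacktriangleright\alpha$ and $\alpha,\Delta\blacktriangleright\Pi$ infer $\Gamma,\Delta\blacktriangleright\Pi$; and operational rules ($\wedge$-l) from $\alpha,\Gamma\blacktriangleright\Pi$ (or from $\beta,\Gamma\blacktriangleright\Pi$) infer $\alpha\wedge\beta,\Gamma\blacktriangleright\Pi$; ($\wedge$-r) from $\Gamma\blacktriangleright\alpha$ and $\Gamma\blacktriangleright\beta$ infer $\Gamma\blacktriangleright\alpha\wedge\beta$; ($\vee$-r) from $\Gamma\blacktriangleright\alpha$ (or from $\Gamma\blacktriangleright\beta$) infer $\Gamma\blacktriangleright\alpha\vee\beta$; ($\vee$-l) from $\alpha,\Gamma\blacktriangleright\Pi$ and $\beta,\Gamma\blacktriangleright\Pi$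 infer $\alpha\vee\beta,\Gamma\blacktriangleright\Pi$; ($\rightarrow$-l(a)) from $\Gamma\blacktriangleright\alpha$ and $\Delta,\beta\blacktriangleright\Pi$ infer $\Delta,\Gamma,\alpha\rightarrow\beta\blacktriangleright\Pi$; ($\rightarrow$-l(b)) from $\neg\alpha,\Gamma\blacktriangleright\beta$ and $\Delta,\alpha,\beta\blacktriangleright$ infer $\Gamma,\Delta,\alpha\rightarrow\beta\blacktriangleright$; ($\rightarrow$-r) from $\alpha,\Gamma\blacktriangleright\beta$ and $\Delta,\neg\alpha,\beta\blacktriangleright$ infer $\Gamma,\Delta\blacktriangleright\alpha\rightarrow\beta$. -}

module Defs where

open import Data.Nat using (ℕ)
open import Data.Bool using (Bool; true; false)
open import Data.List using (List; []; _∷_; _++_; [_])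
open import Data.Maybe using (Maybe; just; nothing)
open import Data.Product using (_×_)
open import Relation.Binary.PropositionalEquality using (_≡_)
open import Data.List.Membership.Propositional using (_∈_)

infixr 6 _∧_
infixr 5 _∨_
infixr 4 _⇒_
data Formula : Set where
  var  : ℕ → Formula
  _∧_  : Formula → Formula → Formula
  _∨_  : Formula → Formula → Formula
  _⇒_  : Formula → Formula → Formula
  ⊥′   : Formula
  ⊤′   : Formula

¬′ : Formula → Formula
¬′ α = α ⇒ ⊥′

-- The antecedent Γ is a finite SET of formulas; we represent it by a list
-- and identify lists with the same elements.
_≈ₛ_ : List Formula → List Formula → Set
Γ ≈ₛ Δ = ∀ {x} → (x ∈ Γ → x ∈ Δ) × (x ∈ Δ → x ∈ Γ)

Stoup : Set
Stoup = Maybe Formula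

-- The index c : Bool says whether (cut) may be used:
-- CHC ⊢[ true ] Γ ▸ Π is ordinary derivability in CHC,
-- CHC ⊢[ false ] Γ ▸ Π is derivability without (cut).
-- Every rule's conclusion antecedent Θ is any list whose set of elements
-- equals the union of the antecedent components in the rule.
data _⊢_▸_ (c : Bool) : List Formula → Stoup → Set where
  ax-id : ∀ {Θ} α → Θ ≈ₛ [ α ] → c ⊢ Θ ▸ just α
  ax-0  : ∀ {Θ} → Θ ≈ₛ [ ⊥′ ] → c ⊢ Θ ▸ nothing
  ax-1  : ∀ {Θ} → Θ ≈ₛ [] → c ⊢ Θ ▸ just ⊤′
  w-l   : ∀ {Γ Π Θ} α → c ⊢ Γ ▸ Π → Θ ≈ₛ (α ∷ Γ) → c ⊢ Θ ▸ Π
  w-r   : ∀ {Γ} α → c ⊢ Γ ▸ nothing → c ⊢ Γ ▸ just α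
  cut   : ∀ {Γ Δ Π Θ} α → c ≡ true → c ⊢ Γ ▸ just α → c ⊢ (α ∷ Δ) ▸ Π
          → Θ ≈ₛ (Γ ++ Δ) → c ⊢ Θ ▸ Π
  ∧-l₁  : ∀ {Γ Π Θ} α β → c ⊢ (α ∷ Γ) ▸ Π → Θ ≈ₛ ((α ∧ β) ∷ Γ) → c ⊢ Θ ▸ Π
  ∧-l₂  : ∀ {Γ Π Θ} α β → c ⊢ (β ∷ Γ) ▸ Π → Θ ≈ₛ ((α ∧ β) ∷ Γ) → c ⊢ Θ ▸ Π
  ∧-r   : ∀ {Γ} α β → c ⊢ Γ ▸ just α → c ⊢ Γ ▸ just β → c ⊢ Γ ▸ just (α ∧ β)
  ∨-r₁  : ∀ {Γ} α β → c ⊢ Γ ▸ just α → c ⊢ Γ ▸ just (α ∨ β)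
  ∨-r₂  : ∀ {Γ} α β → c ⊢ Γ ▸ just β → c ⊢ Γ ▸ just (α ∨ β)
  ∨-l   : ∀ {Γ Π Θ} α β → c ⊢ (α ∷ Γ) ▸ Π → c ⊢ (β ∷ Γ) ▸ Π
          → Θ ≈ₛ ((α ∨ β) ∷ Γ) → c ⊢ Θ ▸ Π
  ⇒-la  : ∀ {Γ Δ Π Θ} α β → c ⊢ Γ ▸ just α → c ⊢ (β ∷ Δ) ▸ Π
          → Θ ≈ₛ (Δ ++ Γ ++ [ α ⇒ β ]) → c ⊢ Θ ▸ Π
  ⇒-lb  : ∀ {Γ Δ Θ} α β → c ⊢ (¬′ α ∷ Γ) ▸ just β → c ⊢ (α ∷ β ∷ Δ) ▸ nothing
          → Θ ≈ₛ (Γ ++ Δ ++ [ α ⇒ β ]) → c ⊢ Θ ▸ nothing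
  ⇒-r   : ∀ {Γ Δ Θ} α β → c ⊢ (α ∷ Γ) ▸ just β → c ⊢ (¬′ α ∷ β ∷ Δ) ▸ nothing
          → Θ ≈ₛ (Γ ++ Δ) → c ⊢ Θ ▸ just (α ⇒ β)

{-# OPTIONS --safe #-}
-- Cut admissibility by induction on the cut formula; for a fixed formula, by
-- induction on the left derivation and, once the cut formula is introduced on
-- the right, on the right derivation. Antecedents are sets, so weakening and
-- contraction are free and every cut is taken in a shared context.
-- The principal (⇒-r)/(⇒-lb) case of β ⇒ γ cuts γ twice, leaving refutations of
-- β and of ¬β; the cut on ¬β = β ⇒ ⊥′ is again a right induction, in which the
-- troublesome (⇒-lb) case just drops ⊥′ from the stoup.
module Submission where

open import Defs
open import Data.Bool using (Bool; true; false)
open import Data.List using (List; []; _∷_; _++_; [_])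
open import Data.Maybe using (just; nothing)
open import Data.Product using (_×_; _,_; proj₁; proj₂)
open import Data.Sum using ([_,_]′)
open import Data.Unit using (⊤; tt)
open import Function using (_∘_)
open import Relation.Nullary using (Dec; yes; no)
open import Relation.Nullary.Negation using (contradiction)
open import Relation.Binary.PropositionalEquality using (_≡_; _≢_; refl)
open import Data.List.Relation.Unary.Any using (here; there)
open import Data.List.Membership.Propositional using (_∈_)
open import Data.List.Membership.Propositional.Properties using (∈-++⁻)
open import Data.List.Relation.Binary.Subset.Propositional using (_⊆_)
open import Data.List.Relation.Binary.Subset.Propositional.Properties
  using (⊆-refl; ⊆-trans; ∷⁺ʳ; ∈-∷⁺ʳ; xs⊆xs++ys; xs⊆ys++xs; ⊆-reflexive-↭)
open import Data.List.Relation.Binary.Permutation.Propositional using (↭-refl; ↭-swap)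

variable
  c : Bool
  α β γ φ ψ : Formula
  Γ Δ Θ : List Formula
  Π : Stoup

≈ₛ-refl : Γ ≈ₛ Γ
≈ₛ-refl = (λ m → m) , (λ m → m)

≈ₛ-trans : Γ ≈ₛ Δ → Δ ≈ₛ Θ → Γ ≈ₛ Θ
≈ₛ-trans e f = proj₁ f ∘ proj₁ e , proj₂ e ∘ proj₂ f

++-⊆ : Γ ⊆ Θ → Δ ⊆ Θ → Γ ++ Δ ⊆ Θ
++-⊆ {Γ} s t = [ s , t ]′ ∘ ∈-++⁻ Γ

++-⊆⁻ : ∀ Γ → Γ ++ Δ ⊆ Θ → Γ ⊆ Θ × Δ ⊆ Θ
++-⊆⁻ {Δ} Γ s = s ∘ xs⊆xs++ys Γ Δ , s ∘ xs⊆ys++xs Δ Γ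

absorb-++ : Γ ⊆ Θ → Θ ≈ₛ (Θ ++ Γ)
absorb-++ {Θ = Θ} s = xs⊆xs++ys Θ _ , ++-⊆ ⊆-refl s

absorb-∷ : φ ∈ Θ → Θ ≈ₛ (φ ∷ Θ)
absorb-∷ m = there , ∈-∷⁺ʳ m ⊆-refl

∷-swap : φ ∷ ψ ∷ Θ ⊆ ψ ∷ φ ∷ Θ
∷-swap {φ} {ψ} = ⊆-reflexive-↭ (↭-swap φ ψ ↭-refl)

∷-under : Δ ⊆ α ∷ Θ → β ∷ Δ ⊆ α ∷ β ∷ Θ
∷-under t = ⊆-trans (∷⁺ʳ _ t) ∷-swap

++-under : ∀ L → Δ ⊆ α ∷ Θ → L ++ Δ ⊆ α ∷ L ++ Θ
++-under []      t = t
++-under (_ ∷ L) t = ∷-under (++-under L t)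

⊢-resp-≈ₛ : c ⊢ Γ ▸ Π → Θ ≈ₛ Γ → c ⊢ Θ ▸ Π
⊢-resp-≈ₛ (ax-id α e)           f = ax-id α (≈ₛ-trans f e)
⊢-resp-≈ₛ (ax-0 e)              f = ax-0 (≈ₛ-trans f e)
⊢-resp-≈ₛ (ax-1 e)              f = ax-1 (≈ₛ-trans f e)
⊢-resp-≈ₛ (w-l α d e)           f = w-l α d (≈ₛ-trans f e)
⊢-resp-≈ₛ (w-r α d)             f = w-r α (⊢-resp-≈ₛ d f)
⊢-resp-≈ₛ (cut α p d₁ d₂ e)     f = cut α p d₁ d₂ (≈ₛ-trans f e)
⊢-resp-≈ₛ (∧-l₁ α β d e)        f = ∧-l₁ α β d (≈ₛ-trans f e)
⊢-resp-≈ₛ (∧-l₂ α β d e)        f = ∧-l₂ α β d (≈ₛ-trans f e)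
⊢-resp-≈ₛ (∧-r α β d₁ d₂)       f = ∧-r α β (⊢-resp-≈ₛ d₁ f) (⊢-resp-≈ₛ d₂ f)
⊢-resp-≈ₛ (∨-r₁ α β d)          f = ∨-r₁ α β (⊢-resp-≈ₛ d f)
⊢-resp-≈ₛ (∨-r₂ α β d)          f = ∨-r₂ α β (⊢-resp-≈ₛ d f)
⊢-resp-≈ₛ (∨-l α β d₁ d₂ e)     f = ∨-l α β d₁ d₂ (≈ₛ-trans f e)
⊢-resp-≈ₛ (⇒-la α β d₁ d₂ e)    f = ⇒-la α β d₁ d₂ (≈ₛ-trans f e)
⊢-resp-≈ₛ (⇒-lb α β d₁ d₂ e)    f = ⇒-lb α β d₁ d₂ (≈ₛ-trans f e)
⊢-resp-≈ₛ (⇒-r α β d₁ d₂ e)     f = ⇒-r α β d₁ d₂ (≈ₛ-trans f e)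

weaken-++ : ∀ L → c ⊢ Γ ▸ Π → c ⊢ L ++ Γ ▸ Π
weaken-++ []      d = d
weaken-++ (φ ∷ L) d = w-l φ (weaken-++ L d) ≈ₛ-refl

weaken : c ⊢ Γ ▸ Π → Γ ⊆ Θ → c ⊢ Θ ▸ Π
weaken {Θ = Θ} d s = ⊢-resp-≈ₛ (weaken-++ Θ d) (absorb-++ s)

weakenʳ : c ⊢ Θ ▸ nothing → c ⊢ Θ ▸ Π
weakenʳ {Π = nothing} d = d
weakenʳ {Π = just φ}  d = w-r φ d

drop-⊥′ : c ⊢ Θ ▸ just ⊥′ → c ⊢ Θ ▸ nothing
drop-⊥′ (ax-id _ e)         = ax-0 e
drop-⊥′ (w-l β d e)         = w-l β (drop-⊥′ d) e
drop-⊥′ (w-r _ d)           = d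
drop-⊥′ (cut β p d₁ d₂ e)   = cut β p d₁ (drop-⊥′ d₂) e
drop-⊥′ (∧-l₁ β γ d e)      = ∧-l₁ β γ (drop-⊥′ d) e
drop-⊥′ (∧-l₂ β γ d e)      = ∧-l₂ β γ (drop-⊥′ d) e
drop-⊥′ (∨-l β γ d₁ d₂ e)   = ∨-l β γ (drop-⊥′ d₁) (drop-⊥′ d₂) e
drop-⊥′ (⇒-la β γ d₁ d₂ e)  = ⇒-la β γ d₁ (drop-⊥′ d₂) e

id′ : φ ∈ Θ → c ⊢ Θ ▸ just φ
id′ m = weaken (ax-id _ ≈ₛ-refl) (∈-∷⁺ʳ m λ ())

zero′ : ⊥′ ∈ Θ → c ⊢ Θ ▸ nothing
zero′ m = weaken (ax-0 ≈ₛ-refl) (∈-∷⁺ʳ m λ ())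

one′ : c ⊢ Θ ▸ just ⊤′
one′ = weaken (ax-1 ≈ₛ-refl) λ ()

∧-l₁′ : (β ∧ γ) ∈ Θ → c ⊢ β ∷ Θ ▸ Π → c ⊢ Θ ▸ Π
∧-l₁′ m d = ∧-l₁ _ _ d (absorb-∷ m)

∧-l₂′ : (β ∧ γ) ∈ Θ → c ⊢ γ ∷ Θ ▸ Π → c ⊢ Θ ▸ Π
∧-l₂′ m d = ∧-l₂ _ _ d (absorb-∷ m)

∨-l′ : (β ∨ γ) ∈ Θ → c ⊢ β ∷ Θ ▸ Π → c ⊢ γ ∷ Θ ▸ Π → c ⊢ Θ ▸ Π
∨-l′ m d₁ d₂ = ∨-l _ _ d₁ d₂ (absorb-∷ m)

⇒-la′ : (β ⇒ γ) ∈ Θ → c ⊢ Θ ▸ just β → c ⊢ γ ∷ Θ ▸ Π → c ⊢ Θ ▸ Π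
⇒-la′ m d₁ d₂ = ⇒-la _ _ d₁ d₂ (absorb-++ (++-⊆ ⊆-refl (∈-∷⁺ʳ m λ ())))

⇒-lb′ : (β ⇒ γ) ∈ Θ → c ⊢ ¬′ β ∷ Θ ▸ just γ → c ⊢ β ∷ γ ∷ Θ ▸ nothing → c ⊢ Θ ▸ nothing
⇒-lb′ m d₁ d₂ = ⇒-lb _ _ d₁ d₂ (absorb-++ (++-⊆ ⊆-refl (∈-∷⁺ʳ m λ ())))

⇒-r′ : c ⊢ β ∷ Θ ▸ just γ → c ⊢ ¬′ β ∷ γ ∷ Θ ▸ nothing → c ⊢ Θ ▸ just (β ⇒ γ)
⇒-r′ d₁ d₂ = ⇒-r _ _ d₁ d₂ (absorb-++ ⊆-refl)

infix 3 _⊢₀_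
_⊢₀_ : List Formula → Stoup → Set
Γ ⊢₀ Π = false ⊢ Γ ▸ Π

Cut : Formula → Set
Cut α = ∀ {Θ Π} → Θ ⊢₀ just α → α ∷ Θ ⊢₀ Π → Θ ⊢₀ Π

NegCut : Formula → Set
NegCut α = ∀ {Θ Π} → α ∷ Θ ⊢₀ nothing → ¬′ α ∷ Θ ⊢₀ Π → Θ ⊢₀ Π

_≟⊥′ : (γ : Formula) → Dec (γ ≡ ⊥′)
var _   ≟⊥′ = no λ ()
(_ ∧ _) ≟⊥′ = no λ ()
(_ ∨ _) ≟⊥′ = no λ ()
(_ ⇒ _) ≟⊥′ = no λ ()
⊥′      ≟⊥′ = yes refl
⊤′      ≟⊥′ = no λ ()

-- The guard breaks a circularity: neg-cut for β is built from SubformulaCuts (β ⇒ ⊥′).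
SubformulaCuts : Formula → Set
SubformulaCuts (β ∧ γ) = Cut β × Cut γ
SubformulaCuts (β ∨ γ) = Cut β × Cut γ
SubformulaCuts (β ⇒ γ) = Cut β × Cut γ × (γ ≢ ⊥′ → NegCut β)
SubformulaCuts _       = ⊤

data RightIntro (Θ : List Formula) : Formula → Set where
  ⊤ᴿ  : RightIntro Θ ⊤′
  ∧ᴿ  : Θ ⊢₀ just β → Θ ⊢₀ just γ → RightIntro Θ (β ∧ γ)
  ∨ᴿ₁ : Θ ⊢₀ just β → RightIntro Θ (β ∨ γ)
  ∨ᴿ₂ : Θ ⊢₀ just γ → RightIntro Θ (β ∨ γ)
  ⇒ᴿ  : β ∷ Θ ⊢₀ just γ → ¬′ β ∷ γ ∷ Θ ⊢₀ nothing → RightIntro Θ (β ⇒ γ)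

RightIntro⇒⊢₀ : RightIntro Θ α → Θ ⊢₀ just α
RightIntro⇒⊢₀ ⊤ᴿ          = one′
RightIntro⇒⊢₀ (∧ᴿ d₁ d₂)  = ∧-r _ _ d₁ d₂
RightIntro⇒⊢₀ (∨ᴿ₁ d)     = ∨-r₁ _ _ d
RightIntro⇒⊢₀ (∨ᴿ₂ d)     = ∨-r₂ _ _ d
RightIntro⇒⊢₀ (⇒ᴿ d₁ d₂)  = ⇒-r′ d₁ d₂

weaken-intro : RightIntro Γ α → Γ ⊆ Θ → RightIntro Θ α
weaken-intro ⊤ᴿ          s = ⊤ᴿ
weaken-intro (∧ᴿ d₁ d₂)  s = ∧ᴿ (weaken d₁ s) (weaken d₂ s)
weaken-intro (∨ᴿ₁ d)     s = ∨ᴿ₁ (weaken d s)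
weaken-intro (∨ᴿ₂ d)     s = ∨ᴿ₂ (weaken d s)
weaken-intro (⇒ᴿ d₁ d₂)  s = ⇒ᴿ (weaken d₁ (∷⁺ʳ _ s)) (weaken d₂ (∷⁺ʳ _ (∷⁺ʳ _ s)))

id-cut : φ ∈ α ∷ Θ → RightIntro Θ α → Θ ⊢₀ just φ
id-cut (here refl) r = RightIntro⇒⊢₀ r
id-cut (there m)   _ = id′ m

zero-cut : ⊥′ ∈ α ∷ Θ → RightIntro Θ α → Θ ⊢₀ nothing
zero-cut (here refl) ()
zero-cut (there m)   _ = zero′ m

∧-l₁-cut : (β ∧ γ) ∈ α ∷ Θ → SubformulaCuts α → RightIntro Θ α → β ∷ Θ ⊢₀ Π → Θ ⊢₀ Π
∧-l₁-cut (here refl) (cut-β , _) (∧ᴿ d _) d′ = cut-β d d′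
∧-l₁-cut (there m)   _           _        d′ = ∧-l₁′ m d′

∧-l₂-cut : (β ∧ γ) ∈ α ∷ Θ → SubformulaCuts α → RightIntro Θ α → γ ∷ Θ ⊢₀ Π → Θ ⊢₀ Π
∧-l₂-cut (here refl) (_ , cut-γ) (∧ᴿ _ d) d′ = cut-γ d d′
∧-l₂-cut (there m)   _           _        d′ = ∧-l₂′ m d′

∨-l-cut : (β ∨ γ) ∈ α ∷ Θ → SubformulaCuts α → RightIntro Θ α
        → β ∷ Θ ⊢₀ Π → γ ∷ Θ ⊢₀ Π → Θ ⊢₀ Π
∨-l-cut (here refl) (cut-β , _) (∨ᴿ₁ d) d₁ _  = cut-β d d₁
∨-l-cut (here refl) (_ , cut-γ) (∨ᴿ₂ d) _  d₂ = cut-γ d d₂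
∨-l-cut (there m)   _           _       d₁ d₂ = ∨-l′ m d₁ d₂

⇒-la-cut : (β ⇒ γ) ∈ α ∷ Θ → SubformulaCuts α → RightIntro Θ α
         → Θ ⊢₀ just β → γ ∷ Θ ⊢₀ Π → Θ ⊢₀ Π
⇒-la-cut (here refl) (cut-β , cut-γ , _) (⇒ᴿ d _) d₁ d₂ = cut-γ (cut-β d₁ d) d₂
⇒-la-cut (there m)   _                   _        d₁ d₂ = ⇒-la′ m d₁ d₂

⇒-lb-cut : (β ⇒ γ) ∈ α ∷ Θ → SubformulaCuts α → RightIntro Θ α
         → (¬′ β ≡ α → Θ ⊢₀ just γ)
         → ¬′ β ∷ Θ ⊢₀ just γ → β ∷ γ ∷ Θ ⊢₀ nothing → Θ ⊢₀ nothing
⇒-lb-cut (there m) _ _ _ d₁ d₂ = ⇒-lb′ m d₁ d₂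
⇒-lb-cut {γ = γ} (here refl) (_ , cut-γ , neg-cut-β) (⇒ᴿ e₁ e₂) cut-¬β d₁ d₂
  with γ ≟⊥′
... | yes refl = drop-⊥′ (cut-¬β refl)
-- cutting γ twice turns the two pairs of premises into refutations of β and of ¬β
... | no γ≢⊥′  = neg-cut-β γ≢⊥′ (cut-γ e₁ (weaken d₂ ∷-swap)) (cut-γ d₁ (weaken e₂ ∷-swap))

module _ (ih : SubformulaCuts α) where

  cut-right : RightIntro Θ α → Δ ⊢₀ Π → Δ ⊆ α ∷ Θ → Θ ⊢₀ Π
  cut-right-++ : ∀ L → RightIntro Θ α → L ++ Δ ⊢₀ Π → Δ ⊆ α ∷ Θ → L ++ Θ ⊢₀ Π

  cut-right r (ax-id φ e)       t = id-cut (t (proj₂ e (here refl))) r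
  cut-right r (ax-0 e)          t = zero-cut (t (proj₂ e (here refl))) r
  cut-right r (ax-1 _)          t = one′
  cut-right r (w-l φ d e)       t = cut-right r d (t ∘ proj₂ e ∘ there)
  cut-right r (w-r φ d)         t = w-r φ (cut-right r d t)
  cut-right r (cut _ () _ _ _)  t
  cut-right r (∧-r β γ d₁ d₂)   t = ∧-r β γ (cut-right r d₁ t) (cut-right r d₂ t)
  cut-right r (∨-r₁ β γ d)      t = ∨-r₁ β γ (cut-right r d t)
  cut-right r (∨-r₂ β γ d)      t = ∨-r₂ β γ (cut-right r d t)
  cut-right r (∧-l₁ β γ d e)    t =
    ∧-l₁-cut (t (proj₂ e (here refl))) ih r (cut-right-++ [ β ] r d (t ∘ proj₂ e ∘ there))
  cut-right r (∧-l₂ β γ d e)    t =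
    ∧-l₂-cut (t (proj₂ e (here refl))) ih r (cut-right-++ [ γ ] r d (t ∘ proj₂ e ∘ there))
  cut-right r (∨-l β γ d₁ d₂ e) t =
    ∨-l-cut (t (proj₂ e (here refl))) ih r
      (cut-right-++ [ β ] r d₁ (t ∘ proj₂ e ∘ there))
      (cut-right-++ [ γ ] r d₂ (t ∘ proj₂ e ∘ there))
  cut-right r (⇒-la {Γ = Γ′} {Δ = Δ′} β γ d₁ d₂ e) t =
    let Δ′⊆ , Γ′φ⊆ = ++-⊆⁻ Δ′ (t ∘ proj₂ e)
        Γ′⊆ , φ⊆   = ++-⊆⁻ Γ′ Γ′φ⊆
    in ⇒-la-cut (φ⊆ (here refl)) ih r (cut-right r d₁ Γ′⊆) (cut-right-++ [ γ ] r d₂ Δ′⊆)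
  cut-right r (⇒-lb {Γ = Γ′} {Δ = Δ′} β γ d₁ d₂ e) t =
    let Γ′⊆ , Δ′φ⊆ = ++-⊆⁻ Γ′ (t ∘ proj₂ e)
        Δ′⊆ , φ⊆   = ++-⊆⁻ Δ′ Δ′φ⊆
    in ⇒-lb-cut (φ⊆ (here refl)) ih r
         -- if ¬β is the cut formula, it is cut out of this premise too
         (λ ¬β≡α → cut-right r d₁ (∈-∷⁺ʳ (here ¬β≡α) Γ′⊆))
         (cut-right-++ [ ¬′ β ] r d₁ Γ′⊆)
         (cut-right-++ (β ∷ γ ∷ []) r d₂ Δ′⊆)
  cut-right r (⇒-r {Γ = Γ′} β γ d₁ d₂ e) t =
    let Γ′⊆ , Δ′⊆ = ++-⊆⁻ Γ′ (t ∘ proj₂ e)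
    in ⇒-r′ (cut-right-++ [ β ] r d₁ Γ′⊆) (cut-right-++ (¬′ β ∷ γ ∷ []) r d₂ Δ′⊆)

  cut-right-++ L r d t = cut-right (weaken-intro r (xs⊆ys++xs _ L)) d (++-under L t)

  cut-left : Γ ⊢₀ just α → Γ ⊆ Θ → α ∷ Θ ⊢₀ Π → Θ ⊢₀ Π
  cut-left-∷ : β ∷ Γ ⊢₀ just α → Γ ⊆ Θ → α ∷ Θ ⊢₀ Π → β ∷ Θ ⊢₀ Π

  cut-left (ax-id _ e)       s d′ = weaken d′ (∈-∷⁺ʳ (s (proj₂ e (here refl))) ⊆-refl)
  cut-left (ax-1 _)          s d′ = cut-right ⊤ᴿ d′ ⊆-refl
  cut-left (w-l φ d e)       s d′ = cut-left d (s ∘ proj₂ e ∘ there) d′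
  cut-left (w-r _ d)         s d′ = weakenʳ (weaken d s)
  cut-left (cut _ () _ _ _)  s d′
  cut-left (∧-r β γ d₁ d₂)   s d′ = cut-right (∧ᴿ (weaken d₁ s) (weaken d₂ s)) d′ ⊆-refl
  cut-left (∨-r₁ β γ d)      s d′ = cut-right (∨ᴿ₁ (weaken d s)) d′ ⊆-refl
  cut-left (∨-r₂ β γ d)      s d′ = cut-right (∨ᴿ₂ (weaken d s)) d′ ⊆-refl
  cut-left (⇒-r {Γ = Γ′} β γ d₁ d₂ e) s d′ =
    let Γ′⊆ , Δ′⊆ = ++-⊆⁻ Γ′ (s ∘ proj₂ e)
    in cut-right (⇒ᴿ (weaken d₁ (∷⁺ʳ β Γ′⊆)) (weaken d₂ (∷⁺ʳ _ (∷⁺ʳ γ Δ′⊆)))) d′ ⊆-refl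
  cut-left (∧-l₁ β γ d e)    s d′ =
    ∧-l₁′ (s (proj₂ e (here refl))) (cut-left-∷ d (s ∘ proj₂ e ∘ there) d′)
  cut-left (∧-l₂ β γ d e)    s d′ =
    ∧-l₂′ (s (proj₂ e (here refl))) (cut-left-∷ d (s ∘ proj₂ e ∘ there) d′)
  cut-left (∨-l β γ d₁ d₂ e) s d′ =
    ∨-l′ (s (proj₂ e (here refl)))
      (cut-left-∷ d₁ (s ∘ proj₂ e ∘ there) d′)
      (cut-left-∷ d₂ (s ∘ proj₂ e ∘ there) d′)
  cut-left (⇒-la {Γ = Γ′} {Δ = Δ′} β γ d₁ d₂ e) s d′ =
    let Δ′⊆ , Γ′φ⊆ = ++-⊆⁻ Δ′ (s ∘ proj₂ e)
        Γ′⊆ , φ⊆   = ++-⊆⁻ Γ′ Γ′φ⊆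
    in ⇒-la′ (φ⊆ (here refl)) (weaken d₁ Γ′⊆) (cut-left-∷ d₂ Δ′⊆ d′)

  cut-left-∷ d s d′ = cut-left d (∷⁺ʳ _ s) (weaken d′ (∷⁺ʳ _ there))

cut-step : ∀ α → SubformulaCuts α → Cut α
cut-step _ ih d d′ = cut-left ih d ⊆-refl d′

neg-cut : Cut α → NegCut α
neg-cut {α = α} cut-α refutation d =
  cut-right {¬′ α} (cut-α , cut-step ⊥′ tt , contradiction refl)
    (⇒ᴿ (w-r ⊥′ refutation) (zero′ (there (here refl)))) d ⊆-refl

cut-admissible : ∀ α → Cut α
cut-admissible (var n) = cut-step (var n) tt
cut-admissible (α ∧ β) = cut-step (α ∧ β) (cut-admissible α , cut-admissible β)
cut-admissible (α ∨ β) = cut-step (α ∨ β) (cut-admissible α , cut-admissible β)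
cut-admissible (α ⇒ β) =
  cut-step (α ⇒ β) (cut-admissible α , cut-admissible β , λ _ → neg-cut (cut-admissible α))
cut-admissible ⊥′      = cut-step ⊥′ tt
cut-admissible ⊤′      = cut-step ⊤′ tt

theorem4p11 : ∀ {Γ Π} → true ⊢ Γ ▸ Π → false ⊢ Γ ▸ Π
theorem4p11 (cut {Γ = Γ} α _ d₁ d₂ e) =
  let Γ⊆ , Δ⊆ = ++-⊆⁻ Γ (proj₂ e)
  in cut-admissible α (weaken (theorem4p11 d₁) Γ⊆) (weaken (theorem4p11 d₂) (∷⁺ʳ α Δ⊆))
theorem4p11 (ax-id α e)        = ax-id α e
theorem4p11 (ax-0 e)           = ax-0 e
theorem4p11 (ax-1 e)           = ax-1 e
theorem4p11 (w-l α d e)        = w-l α (theorem4p11 d) e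
theorem4p11 (w-r α d)          = w-r α (theorem4p11 d)
theorem4p11 (∧-l₁ α β d e)     = ∧-l₁ α β (theorem4p11 d) e
theorem4p11 (∧-l₂ α β d e)     = ∧-l₂ α β (theorem4p11 d) e
theorem4p11 (∧-r α β d₁ d₂)    = ∧-r α β (theorem4p11 d₁) (theorem4p11 d₂)
theorem4p11 (∨-r₁ α β d)       = ∨-r₁ α β (theorem4p11 d)
theorem4p11 (∨-r₂ α β d)       = ∨-r₂ α β (theorem4p11 d)
theorem4p11 (∨-l α β d₁ d₂ e)  = ∨-l α β (theorem4p11 d₁) (theorem4p11 d₂) e
theorem4p11 (⇒-la α β d₁ d₂ e) = ⇒-la α β (theorem4p11 d₁) (theorem4p11 d₂) e
theorem4p11 (⇒-lb α β d₁ d₂ e) = ⇒-lb α β (theorem4p11 d₁) (theorem4p11 d₂) e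
theorem4p11 (⇒-r α β d₁ d₂ e)  = ⇒-r α β (theorem4p11 d₁) (theorem4p11 d₂) e
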